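{- Let $\alpha$ be a paired array with parameters $n,K,\mathbf R,\mathbf q,\mathbf s$ such that the support graph of $\mathbf s$ is a tree. For $1\le i,k\le n$ and $1\le j\le K$, let $s_{i,k,j}$ be the number of vertices in cell $(i,j)$ that are paired with a vertex in row $k$. Then $\alpha$ satisfies the balance condition if and only if $s_{i,k,j}=s_{k,i,j}$ for all $i\ne k$ and all $j$.
   Context: Let $n,K\ge1$, $\mathbf q=(q_1,\dots,q_n)$ non-negative integers, $\mathbf s=(s_{i,k})_{1\le i<k\le n}$ non-negative integers with $s_{k,i}=s_{i,k}$, $s_i=\sum_{k\ne i}s_{i,k}$, $p_i=2q_i+s_i$, and $\mathbf R=(R_1,\dots,R_n)$ with $1\le R_i\le K$. A paired array with these parameters is an $n\times K$ grid of cells (rows $1,\dots,n$, columns $1,\dots,K$); each cell $(i,j)$ contains a possibly empty left-to-right ordered list of unlabelled vertices, row $i$ containing $p_i$ vertices in total; all vertices are partitioned into pairs (each vertex's pair-mate is its partner) such that exactly $q_i$ pairs lie within row $i$ and, for $i<k$, exactly $s_{i,k}$ pairs have one vertex in row $i$ and one in row $k$; and exactly $R_i$ cells of row $i$ are marked. A pair is mixed if its two vertices are in different rows; such vertices are mixed vertices. The balance condition: for every cell $(i,j)$, the number of mixed vertices in cell $(i,j)$ equals the number of mixed pairs $\{u,v\}$ with $u$ in row $i$ and $v$ in column $j$ (in a row other than $i$). The support graph of $\mathbf s$ is the graph on $\{1,\dots,n\}$ with an edge $\{i,k\}$ iff $s_{i,k}>0$. -}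

module Defs where

open import Data.Nat using (ℕ; zero; suc; _+_; _*_; _≤_; _<_)
open import Data.Fin using (Fin; zero; suc; _≟_)
open import Data.Bool using (Bool; true; false; if_then_else_; not)
open import Data.Product using (Σ; _×_; _,_; proj₁; ∃)
open import Data.List using (List; []; _∷_; _++_; [_]; length)
open import Data.List.Relation.Unary.Linked using (Linked)
open import Data.List.Relation.Unary.Unique.Propositional using (Unique)
open import Relation.Nullary using (¬_)
open import Relation.Nullary.Decidable using (⌊_⌋)
open import Relation.Binary.PropositionalEquality using (_≡_; _≢_)

sumF : (m : ℕ) → (Fin m → ℕ) → ℕ
sumF zero    f = 0
sumF (suc m) f = f zero + sumF m (λ x → f (suc x))

count : (m : ℕ) → (Fin m → Bool) → ℕ
count m P = sumF m (λ x → if P x then 1 else 0)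

_=?_ : ∀ {n} → Fin n → Fin n → Bool
i =? k = ⌊ i ≟ k ⌋

module _ {n : ℕ} (s : Fin n → Fin n → ℕ) where

  Adj : Fin n → Fin n → Set
  Adj i k = (i ≢ k) × (0 < s i k)

  data Walk : Fin n → Fin n → Set where
    here : ∀ {i} → Walk i i
    step : ∀ {i j k} → Adj i j → Walk j k → Walk i k

  Connected : Set
  Connected = ∀ i k → Walk i k

  HasCycle : Set
  HasCycle = Σ (Fin n) λ x → Σ (List (Fin n)) λ xs →
             (2 ≤ length xs) × Unique (x ∷ xs) × Linked Adj (x ∷ xs ++ [ x ])

  IsTree : Set
  IsTree = Connected × ¬ HasCycle

-- A vertex is given by its cell (i , j) and its position t in the
-- left-to-right ordered list of that cell (which has size i j entries).
Vert : {n K : ℕ} → (Fin n → Fin K → ℕ) → Set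
Vert {n} {K} size = Σ (Fin n) λ i → Σ (Fin K) λ j → Fin (size i j)

row : ∀ {n K} {size : Fin n → Fin K → ℕ} → Vert size → Fin n
row v = proj₁ v

col : ∀ {n K} {size : Fin n → Fin K → ℕ} → Vert size → Fin K
col (i , j , t) = j

cellCount : ∀ {n K} (size : Fin n → Fin K → ℕ) → Fin n → Fin K →
            (Vert size → Bool) → ℕ
cellCount size i j P = count (size i j) (λ t → P (i , j , t))

rowCount : ∀ {n K} (size : Fin n → Fin K → ℕ) → Fin n →
           (Vert size → Bool) → ℕ
rowCount {K = K} size i P = sumF K (λ j → cellCount size i j P)

sRow : ∀ {n} → (Fin n → Fin n → ℕ) → Fin n → ℕ
sRow {n} s i = sumF n (λ k → if k =? i then 0 else s i k)

record PairedArray (n K : ℕ) (R q : Fin n → ℕ)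
                   (s : Fin n → Fin n → ℕ) : Set where
  field
    size       : Fin n → Fin K → ℕ
    partner    : Vert size → Vert size
    partner-involutive : ∀ v → partner (partner v) ≡ v
    partner-fixfree    : ∀ v → partner v ≢ v
    rowSize    : ∀ i → sumF K (size i) ≡ 2 * q i + sRow s i
    -- exactly q_i pairs within row i (i.e. 2 q_i vertices of row i
    -- have their partner in row i)
    pairsWithin  : ∀ i → rowCount size i (λ v → row (partner v) =? i) ≡ 2 * q i
    -- for i < k exactly s_{i,k} pairs between rows i and k (i.e. exactly
    -- s_{i,k} vertices of row i have their partner in row k)
    pairsBetween : ∀ i k → Data.Fin._<_ i k →
                   rowCount size i (λ v → row (partner v) =? k) ≡ s i k
    marked      : Fin n → Fin K → Bool
    markedCount : ∀ i → count K (marked i) ≡ R i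

  sij : Fin n → Fin n → Fin K → ℕ
  sij i k j = cellCount size i j (λ v → row (partner v) =? k)

  mixedInCell : Fin n → Fin K → ℕ
  mixedInCell i j = cellCount size i j (λ v → not (row (partner v) =? i))

  -- number of mixed pairs {u,v} with u in row i and v in column j, row ≠ i:
  -- counted via v (u is determined as the partner of v)
  mixedPairsTo : Fin n → Fin K → ℕ
  mixedPairsTo i j =
    sumF n (λ k → if k =? i then 0
                  else cellCount size k j (λ v → row (partner v) =? i))

  Balanced : Set
  Balanced = ∀ i j → mixedInCell i j ≡ mixedPairsTo i j

module Submission where

open import Defs
open import Data.Nat using (ℕ; _≤_)
open import Data.Fin using (Fin)
open import Data.Product using (_×_)
open import Function.Bundles using (_⇔_)
open import Relation.Binary.PropositionalEquality using (_≡_; _≢_)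

open import Data.Nat using (zero; suc; _+_; _<_; _<?_; z≤n; s≤s)
open import Data.Nat.Properties
  using (≤-trans; +-mono-≤; +-mono-<-≤; +-mono-≤-<; m≤m+n; m≤n+m; n≤1+n;
         +-identityʳ; +-suc; <-asym; <-irrefl; <⇒≱; ≮⇒≥; ≤-antisym)
open import Data.Nat.Solver using (module +-*-Solver)
open import Data.Fin using (zero; suc; _≟_)
open import Data.Fin.Properties using (any?; pigeonhole; <⇒≢) renaming (<-cmp to <ᶠ-cmp)
open import Data.Bool using (Bool; true; false; if_then_else_; not)
open import Data.Product using (_,_; proj₁; ∃)
open import Data.List using (List; []; _∷_; _++_; [_]; length; lookup)
open import Data.List.Relation.Unary.Linked using (Linked; [-]; _∷_)
open import Data.List.Relation.Unary.AllPairs using (AllPairs; []; _∷_)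
open import Data.List.Relation.Unary.All using (All; []; _∷_)
import Data.List.Relation.Unary.All as All
open import Data.List.Relation.Unary.All.Properties using (¬Any⇒All¬)
import Data.List.Relation.Unary.All.Properties as All
open import Data.List.Relation.Unary.Any using (here; there)
open import Data.List.Relation.Unary.Unique.Propositional using (Unique)
open import Data.List.Membership.Propositional.Properties using (∈-∃++; ∈-lookup)
import Data.List.Membership.DecPropositional as DecMembership
open import Data.Empty using (⊥-elim)
open import Relation.Nullary using (¬_; yes; no)
open import Relation.Nullary.Decidable using (¬?; _×-dec_; dec-true; isYes≗does; ⌊⌋-map′)
open import Relation.Binary.PropositionalEquality using (refl; sym; trans; cong; cong₂; subst; ≢-sym; module ≡-Reasoning)
open import Relation.Binary.Definitions using (tri<; tri≈; tri>)
open import Function.Bundles using (mk⇔)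
open import Function.Base using (_∘_)

-- The mixed vertices of cell (i,j) number Σ_{k≠i} s_{i,k,j}, and the mixed
-- pairs meeting row i and column j number Σ_{k≠i} s_{k,i,j}; so symmetry of
-- s_{·,·,j} gives balance at once.  Conversely fix a column j and orient
-- u → v when s_{u,v,j} > s_{v,u,j}.  Such an arc is an edge of the support
-- graph, and balance at (v,j) makes every arc u → v continue to some v → w.
-- Following arcs in the finite graph must revisit a vertex, and since arcs
-- are antisymmetric the closed walk has length at least 3: a cycle, which
-- the tree does not have.

sumF-cong : ∀ m {f g : Fin m → ℕ} → (∀ x → f x ≡ g x) → sumF m f ≡ sumF m g
sumF-cong zero    f≡g = refl
sumF-cong (suc m) f≡g = cong₂ _+_ (f≡g zero) (sumF-cong m (λ x → f≡g (suc x)))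

sumF-zero : ∀ m {f : Fin m → ℕ} → (∀ x → f x ≡ 0) → sumF m f ≡ 0
sumF-zero zero    f≡0 = refl
sumF-zero (suc m) f≡0 rewrite f≡0 zero = sumF-zero m (λ x → f≡0 (suc x))

sumF-+ : ∀ m (f g : Fin m → ℕ) → sumF m (λ x → f x + g x) ≡ sumF m f + sumF m g
sumF-+ zero    f g = refl
sumF-+ (suc m) f g
  rewrite sumF-+ m (λ x → f (suc x)) (λ x → g (suc x)) =
  interchange (f zero) (g zero) (sumF m (λ x → f (suc x))) (sumF m (λ x → g (suc x)))
  where
  open +-*-Solver
  interchange : ∀ a b c d → (a + b) + (c + d) ≡ (a + c) + (b + d)
  interchange = solve 4 (λ a b c d → (a :+ b) :+ (c :+ d) := (a :+ c) :+ (b :+ d)) refl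

sumF-mono-≤ : ∀ m {f g : Fin m → ℕ} → (∀ x → f x ≤ g x) → sumF m f ≤ sumF m g
sumF-mono-≤ zero    f≤g = z≤n
sumF-mono-≤ (suc m) f≤g = +-mono-≤ (f≤g zero) (sumF-mono-≤ m (λ x → f≤g (suc x)))

sumF-mono-< : ∀ m {f g : Fin m → ℕ} → (∀ x → f x ≤ g x) → ∀ u → f u < g u →
              sumF m f < sumF m g
sumF-mono-< (suc m) f≤g zero    fu<gu = +-mono-<-≤ fu<gu (sumF-mono-≤ m (λ x → f≤g (suc x)))
sumF-mono-< (suc m) f≤g (suc u) fu<gu =
  +-mono-≤-< (f≤g zero) (sumF-mono-< m (λ x → f≤g (suc x)) u fu<gu)

term≤sumF : ∀ m (f : Fin m → ℕ) u → f u ≤ sumF m f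
term≤sumF (suc m) f zero    = m≤m+n (f zero) _
term≤sumF (suc m) f (suc u) = ≤-trans (term≤sumF m (λ x → f (suc x)) u) (m≤n+m _ (f zero))

count-pos⇒∃ : ∀ m (P : Fin m → Bool) → 0 < count m P → ∃ λ t → P t ≡ true
count-pos⇒∃ (suc m) P pos with P zero in P0
... | true  = zero , P0
... | false with count-pos⇒∃ m (λ x → P (suc x)) pos
...   | t , Pt = suc t , Pt

∃⇒count-pos : ∀ m (P : Fin m → Bool) t → P t ≡ true → 0 < count m P
∃⇒count-pos m P t Pt = ≤-trans (indicator-pos Pt) (term≤sumF m (λ x → if P x then 1 else 0) t)
  where
  indicator-pos : ∀ {b} → b ≡ true → 0 < (if b then 1 else 0)
  indicator-pos refl = s≤s z≤n

=?-sound : ∀ {n} {a b : Fin n} → (a =? b) ≡ true → a ≡ b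
=?-sound {a = a} {b} _ with a ≟ b
... | yes a≡b = a≡b
=?-sound ()     | no _

=?-refl : ∀ {n} (a : Fin n) → (a =? a) ≡ true
=?-refl a = trans (isYes≗does (a ≟ a)) (dec-true (a ≟ a) refl)

suc-=?-suc : ∀ {n} (a b : Fin n) → (Fin.suc a =? Fin.suc b) ≡ (a =? b)
suc-=?-suc a b = ⌊⌋-map′ _ _ (a ≟ b)

if-same : ∀ b {x : ℕ} → (if b then x else x) ≡ x
if-same true  = refl
if-same false = refl

sumExcept : ∀ {n} → Fin n → (Fin n → ℕ) → ℕ
sumExcept {n} i f = sumF n (λ k → if k =? i then 0 else f k)

sumExcept-cong : ∀ {n} (i : Fin n) {f g : Fin n → ℕ} → (∀ k → k ≢ i → f k ≡ g k) →
                 sumExcept i f ≡ sumExcept i g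
sumExcept-cong {n} i {f} {g} f≡g = sumF-cong n pointwise
  where
  pointwise : ∀ k → (if k =? i then 0 else f k) ≡ (if k =? i then 0 else g k)
  pointwise k with k ≟ i
  ... | yes _   = refl
  ... | no  k≢i = f≡g k k≢i

sumExcept-mono-< : ∀ {n} (i : Fin n) {f g : Fin n → ℕ} → (∀ k → k ≢ i → f k ≤ g k) →
                   ∀ u → u ≢ i → f u < g u → sumExcept i f < sumExcept i g
sumExcept-mono-< {n} i {f} {g} f≤g u u≢i fu<gu = sumF-mono-< n pointwise u at-u
  where
  pointwise : ∀ k → (if k =? i then 0 else f k) ≤ (if k =? i then 0 else g k)
  pointwise k with k ≟ i
  ... | yes _   = z≤n
  ... | no  k≢i = f≤g k k≢i
  at-u : (if u =? i then 0 else f u) < (if u =? i then 0 else g u)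
  at-u with u ≟ i
  ... | yes u≡i = ⊥-elim (u≢i u≡i)
  ... | no  _   = fu<gu

sumExcept-+ : ∀ {n} (i : Fin n) (f g : Fin n → ℕ) →
              sumExcept i (λ k → f k + g k) ≡ sumExcept i f + sumExcept i g
sumExcept-+ {n} i f g =
  trans (sumF-cong n (λ k → if-+ (k =? i))) (sumF-+ n _ _)
  where
  if-+ : ∀ b {x y} → (if b then 0 else x + y) ≡ (if b then 0 else x) + (if b then 0 else y)
  if-+ true  = refl
  if-+ false = refl

sumExcept-zero : ∀ {n} (i : Fin n) → sumExcept i (λ _ → 0) ≡ 0
sumExcept-zero {n} i = sumF-zero n (λ k → if-same (k =? i))

sumF-indicator : ∀ n (c : Fin n) → sumF n (λ k → if c =? k then 1 else 0) ≡ 1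
sumF-indicator (suc n) zero    = cong suc (sumF-zero n (λ _ → refl))
sumF-indicator (suc n) (suc c) =
  trans (sumF-cong n (λ k → cong (λ b → if b then 1 else 0) (suc-=?-suc c k)))
        (sumF-indicator n c)

sumExcept-indicator : ∀ n (c i : Fin n) →
  sumExcept i (λ k → if c =? k then 1 else 0) ≡ (if not (c =? i) then 1 else 0)
sumExcept-indicator (suc n) zero    zero    = sumF-zero n (λ _ → refl)
sumExcept-indicator (suc n) (suc c) zero    =
  trans (sumF-cong n (λ k → cong (λ b → if b then 1 else 0) (suc-=?-suc c k)))
        (sumF-indicator n c)
sumExcept-indicator (suc n) zero    (suc i) =
  cong suc (sumF-zero n (λ k → if-same (Fin.suc k =? Fin.suc i)))
sumExcept-indicator (suc n) (suc c) (suc i) = begin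
  sumF n (λ k → if Fin.suc k =? Fin.suc i then 0 else (if Fin.suc c =? Fin.suc k then 1 else 0))
    ≡⟨ sumF-cong n (λ k → cong₂ (λ b b′ → if b then 0 else (if b′ then 1 else 0))
                                (suc-=?-suc k i) (suc-=?-suc c k)) ⟩
  sumExcept i (λ k → if c =? k then 1 else 0)
    ≡⟨ sumExcept-indicator n c i ⟩
  (if not (c =? i) then 1 else 0)
    ≡⟨ cong (λ b → if not b then 1 else 0) (sym (suc-=?-suc c i)) ⟩
  (if not (Fin.suc c =? Fin.suc i) then 1 else 0) ∎
  where open ≡-Reasoning

count-≢-fibres : ∀ {n} m (g : Fin m → Fin n) (i : Fin n) →
  count m (λ t → not (g t =? i)) ≡ sumExcept i (λ k → count m (λ t → g t =? k))
count-≢-fibres zero    g i = sym (sumExcept-zero i)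
count-≢-fibres (suc m) g i = sym (begin
  sumExcept i (λ k → (if g zero =? k then 1 else 0) + count m (λ t → g (suc t) =? k))
    ≡⟨ sumExcept-+ i _ _ ⟩
  sumExcept i (λ k → if g zero =? k then 1 else 0) + sumExcept i (λ k → count m (λ t → g (suc t) =? k))
    ≡⟨ cong₂ _+_ (sumExcept-indicator _ (g zero) i) (sym (count-≢-fibres m (λ t → g (suc t)) i)) ⟩
  (if not (g zero =? i) then 1 else 0) + count m (λ t → not (g (suc t) =? i)) ∎)
  where open ≡-Reasoning

lookup-injective : ∀ {A : Set} {xs : List A} → Unique xs →
                   ∀ i j → lookup xs i ≡ lookup xs j → i ≡ j
lookup-injective (_   ∷ _)   zero    zero    _ = refl
lookup-injective (x∉ ∷ _)    zero    (suc j) e = ⊥-elim (All.lookup x∉ (∈-lookup j) e)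
lookup-injective (x∉ ∷ _)    (suc i) zero    e = ⊥-elim (All.lookup x∉ (∈-lookup i) (sym e))
lookup-injective (_   ∷ xs!) (suc i) (suc j) e = cong suc (lookup-injective xs! i j e)

Unique⇒length≤ : ∀ {n} {xs : List (Fin n)} → Unique xs → length xs ≤ n
Unique⇒length≤ {xs = xs} xs! = ≮⇒≥ λ n<len →
  let i , j , i<j , e = pigeonhole n<len (lookup xs)
  in <⇒≢ i<j (lookup-injective xs! i j e)

AllPairs-prefix : ∀ {A : Set} {R : A → A → Set} xs {w zs} →
                  AllPairs R (xs ++ w ∷ zs) → AllPairs R (xs ++ [ w ])
AllPairs-prefix []       (_  ∷ _)   = [] ∷ []
AllPairs-prefix (x ∷ xs) (Rx ∷ Rxs) = All-prefix Rx ∷ AllPairs-prefix xs Rxs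
  where
  All-prefix : ∀ {P : _ → Set} {w zs} → All P (xs ++ w ∷ zs) → All P (xs ++ [ w ])
  All-prefix Pxs = let Pys , Pwzs = All.++⁻ xs Pxs in All.++⁺ Pys (All.head Pwzs ∷ [])

Linked-close : ∀ {A : Set} {R : A → A → Set} xs {w zs y} →
               Linked R (xs ++ w ∷ zs) → R w y → Linked R ((xs ++ [ w ]) ++ [ y ])
Linked-close []            _            Rwy = Rwy ∷ [-]
Linked-close (x ∷ [])      (Rxw ∷ _)    Rwy = Rxw ∷ Rwy ∷ [-]
Linked-close (x ∷ x′ ∷ xs) (Rxx′ ∷ Rxs) Rwy = Rxx′ ∷ Linked-close (x′ ∷ xs) Rxs Rwy

module _ {n : ℕ} (s : Fin n → Fin n → ℕ) (s-sym : ∀ i k → s i k ≡ s k i) where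

  Adj-sym : ∀ {u v} → Adj s u v → Adj s v u
  Adj-sym (u≢v , pos) = ≢-sym u≢v , subst (0 <_) (s-sym _ _) pos

  module _ (E : Fin n → Fin n → Set)
           (E⇒Adj : ∀ {u v} → E u v → Adj s u v)
           (E-asym : ∀ {u v} → E u v → ¬ E v u)
           (E-continues : ∀ {u v} → E u v → ∃ λ w → E v w) where

    private module M = DecMembership (_≟_ {n})

    -- h ∷ p ∷ M is a simple path listed backwards: the walk reached h from p.
    -- The fuel bounds the number of extensions, since a simple path has at
    -- most n vertices.
    extend : ∀ fuel h p M → n < length (h ∷ p ∷ M) + fuel →
             Unique (h ∷ p ∷ M) → Linked (Adj s) (h ∷ p ∷ M) → E p h → HasCycle s
    extend zero h p M n<len path! _ _ =
      ⊥-elim (<⇒≱ (subst (n <_) (+-identityʳ _) n<len) (Unique⇒length≤ path!))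
    extend (suc fuel) h p M n<len path! path Eph with E-continues Eph
    ... | w , Ehw with w M.∈? (h ∷ p ∷ M)
    ...   | no w∉ = extend fuel w h (p ∷ M) (subst (n <_) (+-suc _ fuel) n<len)
                      (¬Any⇒All¬ _ w∉ ∷ path!) (Adj-sym (E⇒Adj Ehw) ∷ path) Ehw
    ...   | yes (here w≡h)          = ⊥-elim (proj₁ (E⇒Adj Ehw) (sym w≡h))
    ...   | yes (there (here w≡p))  = ⊥-elim (E-asym Eph (subst (E h) w≡p Ehw))
    ...   | yes (there (there w∈M)) with ∈-∃++ w∈M
    ...     | ys , zs , refl =
      h , p ∷ ys ++ [ w ] , s≤s (length≥1 ys) ,
      AllPairs-prefix (h ∷ p ∷ ys) path! ,
      Linked-close (h ∷ p ∷ ys) path (Adj-sym (E⇒Adj Ehw))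
      where
      length≥1 : ∀ ys → 1 ≤ length (ys ++ [ w ])
      length≥1 []      = s≤s z≤n
      length≥1 (_ ∷ _) = s≤s z≤n

    continuable⇒HasCycle : ∀ {a b} → E a b → HasCycle s
    continuable⇒HasCycle Eab =
      extend n _ _ [] (n≤1+n (suc n))
        (((≢-sym (proj₁ (E⇒Adj Eab))) ∷ []) ∷ [] ∷ [])
        (Adj-sym (E⇒Adj Eab) ∷ [-]) Eab

module _ {n K : ℕ} {R q : Fin n → ℕ} {s : Fin n → Fin n → ℕ}
         (α : PairedArray n K R q s) where
  open PairedArray α

  SijSymmetric : Set
  SijSymmetric = ∀ i k j → i ≢ k → sij i k j ≡ sij k i j

  mixedInCell≡sumExcept : ∀ i j → mixedInCell i j ≡ sumExcept i (λ k → sij i k j)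
  mixedInCell≡sumExcept i j = count-≢-fibres (size i j) (λ t → row (partner (i , j , t))) i

  symmetric⇒Balanced : SijSymmetric → Balanced
  symmetric⇒Balanced sij-sym i j =
    trans (mixedInCell≡sumExcept i j)
          (sumExcept-cong i (λ k k≢i → sij-sym i k j (≢-sym k≢i)))

  rowCount-pos : ∀ (P : Vert size → Bool) v → P v ≡ true → 0 < rowCount size (row v) P
  rowCount-pos P (i , j , t) Pv =
    ≤-trans (∃⇒count-pos (size i j) (λ t → P (i , j , t)) t Pv)
            (term≤sumF K (λ j → cellCount size i j P) j)

  mixed-pair⇒edge : (∀ i k → s i k ≡ s k i) →
                    ∀ v → row v ≢ row (partner v) → 0 < s (row v) (row (partner v))
  mixed-pair⇒edge s-sym v rows≢ with <ᶠ-cmp (row v) (row (partner v))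
  ... | tri< v<v′ _ _ =
    subst (0 <_) (pairsBetween _ _ v<v′)
          (rowCount-pos (λ w → row (partner w) =? row (partner v)) v (=?-refl _))
  ... | tri≈ _ v≡v′ _ = ⊥-elim (rows≢ v≡v′)
  ... | tri> _ _ v′<v =
    subst (0 <_) (trans (pairsBetween _ _ v′<v) (s-sym _ _))
          (rowCount-pos (λ w → row (partner w) =? row v) (partner v)
                        (subst (λ x → (row x =? row v) ≡ true)
                               (sym (partner-involutive v)) (=?-refl _)))

  sij-pos⇒Adj : (∀ i k → s i k ≡ s k i) → ∀ {i k} j → i ≢ k → 0 < sij i k j → Adj s i k
  sij-pos⇒Adj s-sym {i} {k} j i≢k pos with count-pos⇒∃ (size i j) _ pos
  ... | t , partner-in-k with =?-sound partner-in-k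
  ...   | refl = i≢k , mixed-pair⇒edge s-sym (i , j , t) i≢k

  Excess : Fin K → Fin n → Fin n → Set
  Excess j u v = u ≢ v × sij v u j < sij u v j

  Balanced⇒Excess-continues : Balanced → ∀ j {u v} → Excess j u v → ∃ λ w → Excess j v w
  Balanced⇒Excess-continues bal j {u} {v} (u≢v , excess)
    with any? (λ w → ¬? (v ≟ w) ×-dec (sij w v j <? sij v w j))
  ... | yes continuation = continuation
  ... | no  stuck        = ⊥-elim (<-irrefl balance-at-v out<in)
    where
    balance-at-v : sumExcept v (λ w → sij v w j) ≡ sumExcept v (λ w → sij w v j)
    balance-at-v = trans (sym (mixedInCell≡sumExcept v j)) (bal v j)
    out<in : sumExcept v (λ w → sij v w j) < sumExcept v (λ w → sij w v j)
    out<in = sumExcept-mono-< v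
      (λ w w≢v → ≮⇒≥ (λ in<out → stuck (w , (≢-sym w≢v) , in<out)))
      u u≢v excess

  acyclic-Balanced⇒no-Excess : (∀ i k → s i k ≡ s k i) → ¬ HasCycle s → Balanced →
                               ∀ j {u v} → ¬ Excess j u v
  acyclic-Balanced⇒no-Excess s-sym acyclic bal j = acyclic ∘ continuable⇒HasCycle s s-sym
    (Excess j)
    (λ (u≢v , excess) → sij-pos⇒Adj s-sym j u≢v (≤-trans (s≤s z≤n) excess))
    (λ (_ , excess) (_ , excess′) → <-asym excess excess′)
    (Balanced⇒Excess-continues bal j)

  Balanced⇒symmetric : (∀ i k → s i k ≡ s k i) → ¬ HasCycle s → Balanced → SijSymmetric
  Balanced⇒symmetric s-sym acyclic bal i k j i≢k =
    ≤-antisym (≮⇒≥ (λ ki<ik → no-excess (i≢k , ki<ik)))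
              (≮⇒≥ (λ ik<ki → no-excess (≢-sym i≢k , ik<ki)))
    where
    no-excess : ∀ {u v} → ¬ Excess j u v
    no-excess = acyclic-Balanced⇒no-Excess s-sym acyclic bal j

lemma2p5 : (n K : ℕ) → 1 ≤ n → 1 ≤ K →
  (R q : Fin n → ℕ) → (s : Fin n → Fin n → ℕ) →
  (∀ i → (1 ≤ R i) × (R i ≤ K)) →
  (∀ i k → s i k ≡ s k i) →
  (α : PairedArray n K R q s) →
  IsTree s →
  PairedArray.Balanced α ⇔
    (∀ i k j → i ≢ k → PairedArray.sij α i k j ≡ PairedArray.sij α k i j)
lemma2p5 n K _ _ R q s _ s-sym α (_ , acyclic) =
  mk⇔ (Balanced⇒symmetric α s-sym acyclic) (symmetric⇒Balanced α)
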